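{- Let $H_A$ be the ordered graph on vertex set $\{1,2,3,4\}$ with edge set $\{\{1,2\},\{3,4\}\}$ (an ordering of $K_2\cup K_2$). Then $r_<(H_A)=6$.
   Context: An ordered graph on $n$ vertices is a graph with vertex set $[n]=\{1,\dots,n\}$ equipped with the natural order. Given an ordered graph $H$ on $[n]$ and a red/blue coloring of the edges of the complete graph $K_N$ on vertex set $[N]$, a monochromatic ordered copy of $H$ is a strictly increasing map $\phi:[n]\to[N]$ such that all edges $\{\phi(i),\phi(j)\}$ with $\{i,j\}\in E(H)$ receive the same color. The ordered Ramsey number $r_<(H)$ is the least $N$ such that every red/blue coloring of the edges of the complete graph on $[N]$ contains a monochromatic ordered copy of $H$. -}

module Defs where

import Data.Nat
open import Data.Nat using (ℕ)
open import Data.Fin using (Fin; zero; suc; _<_)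
open import Data.Bool using (Bool)
open import Data.Product using (Σ; _×_; ∃)
open import Relation.Binary.PropositionalEquality using (_≡_)
open import Relation.Nullary using (¬_)

-- An ordered graph on [n] (vertices Fin n, natural order).
-- Edges are given as a relation E on ordered pairs (i , j) with i < j:
-- the unordered edge {i,j} (i<j) is present iff E i j.
record OrderedGraph (n : ℕ) : Set₁ where
  field
    E      : Fin n → Fin n → Set
    E-lt   : ∀ {i j} → E i j → i < j

-- A red/blue colouring of the edges of K_N on [N]:
-- the edge {a,b} with a < b receives colour  c a b  (values of c at a ≥ b are irrelevant).
Colouring : ℕ → Set
Colouring N = Fin N → Fin N → Bool

StrictlyIncreasing : ∀ {n N} → (Fin n → Fin N) → Set
StrictlyIncreasing {n} φ = ∀ {i j : Fin n} → i < j → φ i < φ j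

MonoCopy : ∀ {n N} → OrderedGraph n → Colouring N → Set
MonoCopy {n} {N} H c =
  Σ (Fin n → Fin N) λ φ → StrictlyIncreasing φ ×
    Σ Bool λ col → ∀ (i j : Fin n) → OrderedGraph.E H i j → c (φ i) (φ j) ≡ col

Arrows : ∀ {n} → ℕ → OrderedGraph n → Set
Arrows N H = (c : Colouring N) → MonoCopy H c

OrderedRamseyNumber : ∀ {n} → OrderedGraph n → ℕ → Set
OrderedRamseyNumber H N = Arrows N H × (∀ M → M Data.Nat.< N → ¬ Arrows M H)

-- H_A : vertices 1,2,3,4 (Fin 4: 0,1,2,3), edges {1,2}, {3,4}.
data HA-edge : Fin 4 → Fin 4 → Set where
  e12 : HA-edge zero (suc zero)
  e34 : HA-edge (suc (suc zero)) (suc (suc (suc zero)))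

HA-lt : ∀ {i j} → HA-edge i j → i < j
HA-lt e12 = Data.Nat.s≤s Data.Nat.z≤n
HA-lt e34 = Data.Nat.s≤s (Data.Nat.s≤s (Data.Nat.s≤s Data.Nat.z≤n))

H-A : OrderedGraph 4
H-A = record { E = HA-edge ; E-lt = HA-lt }

-- Among the three disjoint edges {1,2}, {3,4}, {5,6} of K_6 two have the same
-- colour, and any two of them form an ordered copy of H_A.  On five vertices,
-- colour an edge by whether its right endpoint is among the first three
-- vertices: in an ordered copy of H_A on at most five vertices the second
-- vertex always is and the fourth never is, so the two edges differ in colour.
module Submission where

open import Defs
open import Data.Nat as ℕ using (ℕ; _+_; _≤ᵇ_; z≤n; s≤s)
open import Data.Nat.Properties using (<-trans; ≤-pred; ≤ᵇ⇒≤; ≤⇒≤ᵇ; <⇒≱; module ≤-Reasoning)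
open ≤-Reasoning
open import Data.Fin using (Fin; zero; suc; toℕ; inject₁; #_; _<_)
open import Data.Fin.Properties using (toℕ<n; _<?_)
open import Data.Bool using (Bool; true; false; T)
open import Data.Product using (_,_; _×_)
open import Data.Sum using (_⊎_; inj₁; inj₂; [_,_]′)
open import Relation.Binary.PropositionalEquality using (_≡_; refl; sym; trans; subst)
open import Function using (_∘_)
open import Relation.Nullary using (¬_)
open import Relation.Nullary.Decidable using (True; toWitness)

stepwise⇒strictlyIncreasing : ∀ {n N} (φ : Fin (ℕ.suc n) → Fin N) →
                              (∀ i → φ (inject₁ i) < φ (suc i)) → StrictlyIncreasing φ
stepwise⇒strictlyIncreasing φ step {zero} {suc zero} _ = step zero
stepwise⇒strictlyIncreasing {ℕ.suc n} φ step {zero} {suc (suc j)} _ =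
  <-trans (step zero) (stepwise⇒strictlyIncreasing (φ ∘ suc) (step ∘ suc) {zero} {suc j} (s≤s z≤n))
stepwise⇒strictlyIncreasing {ℕ.suc n} φ step {suc i} {suc j} (s≤s i<j) =
  stepwise⇒strictlyIncreasing (φ ∘ suc) (step ∘ suc) i<j

quadruple : ∀ {N} → Fin N → Fin N → Fin N → Fin N → Fin 4 → Fin N
quadruple a b c d zero                   = a
quadruple a b c d (suc zero)             = b
quadruple a b c d (suc (suc zero))       = c
quadruple a b c d (suc (suc (suc zero))) = d

quadruple-strictlyIncreasing : ∀ {N} {a b c d : Fin N} → a < b → b < c → c < d →
                               StrictlyIncreasing (quadruple a b c d)
quadruple-strictlyIncreasing {a = a} {b} {c} {d} a<b b<c c<d =
  stepwise⇒strictlyIncreasing (quadruple a b c d) step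
  where
  step : ∀ i → quadruple a b c d (inject₁ i) < quadruple a b c d (suc i)
  step zero             = a<b
  step (suc zero)       = b<c
  step (suc (suc zero)) = c<d

HA-copy : ∀ {N} (col : Colouring N) {a b c d : Fin N} → a < b → b < c → c < d →
          col a b ≡ col c d → MonoCopy H-A col
HA-copy col {a} {b} {c} {d} a<b b<c c<d same =
  quadruple a b c d , quadruple-strictlyIncreasing a<b b<c c<d , col a b , mono
  where
  mono : ∀ i j → HA-edge i j → col (quadruple a b c d i) (quadruple a b c d j) ≡ col a b
  mono _ _ e12 = refl
  mono _ _ e34 = sym same

two-of-three-equal : (x y z : Bool) → x ≡ y ⊎ x ≡ z ⊎ y ≡ z
two-of-three-equal false false _     = inj₁ refl
two-of-three-equal true  true  _     = inj₁ refl
two-of-three-equal false true  false = inj₂ (inj₁ refl)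
two-of-three-equal true  false true  = inj₂ (inj₁ refl)
two-of-three-equal false true  true  = inj₂ (inj₂ refl)
two-of-three-equal true  false false = inj₂ (inj₂ refl)

arrows-6 : Arrows 6 H-A
arrows-6 col =
  [ copy (# 0) (# 1) (# 2) (# 3) , [ copy (# 0) (# 1) (# 4) (# 5) , copy (# 2) (# 3) (# 4) (# 5) ]′ ]′
    (two-of-three-equal (col (# 0) (# 1)) (col (# 2) (# 3)) (col (# 4) (# 5)))
  where
  copy : (a b c d : Fin 6) {a<b : True (a <? b)} {b<c : True (b <? c)} {c<d : True (c <? d)} →
         col a b ≡ col c d → MonoCopy H-A col
  copy a b c d {a<b} {b<c} {c<d} = HA-copy col (toWitness a<b) (toWitness b<c) (toWitness c<d)

rightEndpointColouring : ∀ M → Colouring M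
rightEndpointColouring M a b = toℕ b ≤ᵇ 2

strictlyIncreasing-positions : ∀ {M} {φ : Fin 4 → Fin M} → StrictlyIncreasing φ → M ℕ.≤ 5 →
                               toℕ (φ (# 1)) ℕ.≤ 2 × 2 ℕ.< toℕ (φ (# 3))
strictlyIncreasing-positions {M} {φ} inc M≤5 = second≤2 , 2<fourth
  where
  position : Fin 4 → ℕ
  position i = toℕ (φ i)

  position-step : (i j : Fin 4) {i<j : True (i <? j)} → position i ℕ.< position j
  position-step i j {i<j} = inc {i} {j} (toWitness i<j)

  second≤2 : position (# 1) ℕ.≤ 2
  second≤2 = ≤-pred (≤-pred (≤-pred (begin
    3 + position (# 1) ≤⟨ s≤s (s≤s (position-step (# 1) (# 2))) ⟩
    2 + position (# 2) ≤⟨ s≤s (position-step (# 2) (# 3)) ⟩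
    1 + position (# 3) ≤⟨ toℕ<n (φ (# 3)) ⟩
    M                  ≤⟨ M≤5 ⟩
    5                  ∎)))

  2<fourth : 2 ℕ.< position (# 3)
  2<fourth = begin
    3                  ≤⟨ s≤s (s≤s (s≤s z≤n)) ⟩
    3 + position (# 0) ≤⟨ s≤s (s≤s (position-step (# 0) (# 1))) ⟩
    2 + position (# 1) ≤⟨ s≤s (position-step (# 1) (# 2)) ⟩
    1 + position (# 2) ≤⟨ position-step (# 2) (# 3) ⟩
    position (# 3)     ∎

¬arrows-<6 : ∀ M → M ℕ.< 6 → ¬ Arrows M H-A
¬arrows-<6 M M<6 arrows with arrows (rightEndpointColouring M)
... | φ , inc , _ , mono with strictlyIncreasing-positions inc (≤-pred M<6)
...   | second≤2 , 2<fourth =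
  <⇒≱ 2<fourth (≤ᵇ⇒≤ _ 2 (subst T sameColour (≤⇒≤ᵇ second≤2)))
  where
  sameColour : (toℕ (φ (# 1)) ≤ᵇ 2) ≡ (toℕ (φ (# 3)) ≤ᵇ 2)
  sameColour = trans (mono _ _ e12) (sym (mono _ _ e34))

proposition2p1 : OrderedRamseyNumber H-A 6
proposition2p1 = arrows-6 , ¬arrows-<6
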